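{- Let $d\geq 2$ be an integer, $q=4^d$, $\omega$ a generator of the multiplicative group $\mathbb{F}_q^\times$. For $u\in\mathbb{F}_q$ let $R(u)\in\mathrm{Sym}(\mathbb{F}_q)$ be $v\mapsto v+u$, let $V=\{R(u)\mid u\in\mathbb{F}_q\}$, and let $s,\varphi\in\mathrm{Sym}(\mathbb{F}_q)$ be $s\colon v\mapsto v\omega$ and $\varphi\colon v\mapsto v^2$. Let $G=\langle V, s^{2^d-1},\varphi^d\rangle$ $(=V\rtimes(\langle s^{2^d-1}\rangle\rtimes\langle\varphi^d\rangle))$, $A=\langle V,\varphi^d\rangle$ $(=V\rtimes\langle\varphi^d\rangle)$ and $H=\langle R(\omega),R(\omega^{2^d})\rangle$. Then: (a) $|A\{g,g^{ -1}\}A|/|A|$ is even for each $g\in G\setminus A$; (b) $A$ is not a perfect code of the pair $(G,H)$.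
   Context: Permutations act on the right. Graphs are finite, undirected and simple; a subset $C$ of the vertex set $V$ of a graph is a perfect code if every vertex in $V\setminus C$ is adjacent to exactly one vertex of $C$. For a group $G$, $H\leq G$ and an inverse-closed subset $U\subseteq G\setminus H$, the coset graph $\mathrm{Cos}(G,H,U)$ has vertices the left cosets of $H$ in $G$, with $xH$, $yH$ adjacent iff $x^{ -1}y\in HUH$. A subgroup $A$ with $H\leq A\leq G$ is a perfect code of the pair $(G,H)$ if for some such $U$ the set of left cosets of $H$ contained in $A$ is a perfect code in $\mathrm{Cos}(G,H,U)$. -}

module Defs where

open import Level using (Level; _⊔_)
open import Data.Nat using (ℕ; zero; suc)
import Data.Nat as ℕ
open import Data.Fin using (Fin)
open import Data.Product using (Σ; ∃; _×_; _,_)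
open import Data.Sum using (_⊎_)
open import Data.List using (List; length)
open import Data.List.Relation.Unary.All using (All)
open import Relation.Nullary using (¬_)
open import Relation.Unary using (Pred)
open import Relation.Binary using (Setoid)
open import Relation.Binary.PropositionalEquality using (_≡_)
import Relation.Binary.PropositionalEquality as ≡
open import Function.Bundles using (Inverse)
import Function.Construct.Composition as Comp
import Function.Construct.Symmetry as Sym
import Function.Construct.Identity as Id
open import Algebra.Bundles using (CommutativeRing)
import Data.List.Membership.Setoid as SetoidMembership
import Data.List.Relation.Unary.Unique.Setoid as SetoidUnique

module _ {c ℓ : Level} (F : CommutativeRing c ℓ) where
  open CommutativeRing F

  record IsField : Set (c ⊔ ℓ) where
    field
      1≉0 : ¬ (1# ≈ 0#)
      inverse : ∀ x → ¬ (x ≈ 0#) → ∃ λ y → x * y ≈ 1#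

  pow : Carrier → ℕ → Carrier
  pow x zero = 1#
  pow x (suc n) = x * pow x n

  HasCardinality : ℕ → Set (c ⊔ ℓ)
  HasCardinality q = Inverse (≡.setoid (Fin q)) setoid

  IsMultGenerator : Carrier → Set (c ⊔ ℓ)
  IsMultGenerator ω = ¬ (ω ≈ 0#) × (∀ x → ¬ (x ≈ 0#) → ∃ λ k → x ≈ pow ω k)

module _ {a ℓ : Level} (S : Setoid a ℓ) where
  open Setoid S
  open SetoidMembership S using (_∈_)
  open SetoidUnique S using (Unique)

  HasSize : ∀ {p} → Pred Carrier p → ℕ → Set (a ⊔ ℓ ⊔ p)
  HasSize P n = Σ (List Carrier) λ xs →
    length xs ≡ n × All P xs × Unique xs × (∀ x → P x → x ∈ xs)

-- The symmetric group Sym(S) of a setoid S; permutations act on the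
-- right, so (x · y) means "first x, then y".

module SymGroup {a ℓ : Level} (S : Setoid a ℓ) where
  open Setoid S renaming (Carrier to X; _≈_ to _≈ₓ_)

  Perm : Set (a ⊔ ℓ)
  Perm = Inverse S S

  _≃_ : Perm → Perm → Set (a ⊔ ℓ)
  f ≃ g = ∀ x → Inverse.to f x ≈ₓ Inverse.to g x

  idp : Perm
  idp = Id.inverse S

  _·_ : Perm → Perm → Perm
  f · g = Comp.inverse f g

  _⁻¹ : Perm → Perm
  f ⁻¹ = Sym.inverse f

  _^ₚ_ : Perm → ℕ → Perm
  f ^ₚ zero = idp
  f ^ₚ suc n = f · (f ^ₚ n)

  infixl 7 _·_
  infix 8 _⁻¹

  PermSetoid : Setoid (a ⊔ ℓ) (a ⊔ ℓ)
  PermSetoid = record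
    { Carrier = Perm
    ; _≈_ = _≃_
    ; isEquivalence = record
      { refl = λ x → Setoid.refl S
      ; sym = λ p x → Setoid.sym S (p x)
      ; trans = λ p q x → Setoid.trans S (p x) (q x) } }

  data ⟨_⟩ {p} (T : Pred Perm p) : Pred Perm (a ⊔ ℓ ⊔ p) where
    gen  : ∀ {x} → T x → ⟨ T ⟩ x
    one  : ⟨ T ⟩ idp
    mul  : ∀ {x y} → ⟨ T ⟩ x → ⟨ T ⟩ y → ⟨ T ⟩ (x · y)
    inv  : ∀ {x} → ⟨ T ⟩ x → ⟨ T ⟩ (x ⁻¹)
    resp : ∀ {x y} → x ≃ y → ⟨ T ⟩ x → ⟨ T ⟩ y

  module _ {p} (G H A : Pred Perm p) where

    InHUH : Pred Perm (a ⊔ ℓ) → Perm → Set (a ⊔ ℓ ⊔ p)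
    InHUH U x = ∃ λ h → ∃ λ u → ∃ λ h′ →
      H h × U u × H h′ × (x ≃ (h · u · h′))

    -- adjacency of the vertices xH and yH in Cos(G,H,U)
    Adj : Pred Perm (a ⊔ ℓ) → Perm → Perm → Set (a ⊔ ℓ ⊔ p)
    Adj U x y = InHUH U (x ⁻¹ · y)

    CosetInA : Perm → Set (a ⊔ ℓ ⊔ p)
    CosetInA x = ∀ h → H h → A (x · h)

    SameCoset : Perm → Perm → Set p
    SameCoset x y = H (x ⁻¹ · y)

    -- the set of cosets of H contained in A is a perfect code of Cos(G,H,U):
    -- every vertex xH (x ∈ G) outside it is adjacent to exactly one vertex in it
    IsPerfectCodeIn : Pred Perm (a ⊔ ℓ) → Set (a ⊔ ℓ ⊔ p)
    IsPerfectCodeIn U = ∀ x → G x → ¬ CosetInA x →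
      (∃ λ c → G c × CosetInA c × Adj U x c) ×
      (∀ c c′ → G c → G c′ → CosetInA c → CosetInA c′ →
         Adj U x c → Adj U x c′ → SameCoset c c′)

    IsPerfectCodeOfPair : Set (Level.suc (a ⊔ ℓ) ⊔ p)
    IsPerfectCodeOfPair = ∃ λ (U : Pred Perm (a ⊔ ℓ)) →
      (∀ u → U u → G u × ¬ H u) ×
      (∀ u → U u → U (u ⁻¹)) ×
      IsPerfectCodeIn U

module Prop35Setup {c ℓ : Level} (F : CommutativeRing c ℓ) (d : ℕ) (ω : CommutativeRing.Carrier F) where
  open CommutativeRing F
  open SymGroup setoid public

  IsR : Carrier → Perm → Set (c ⊔ ℓ)
  IsR u g = ∀ v → Inverse.to g v ≈ v + u

  V : Pred Perm (c ⊔ ℓ)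
  V g = ∃ λ u → IsR u g

  IsSPow : Perm → Set (c ⊔ ℓ)
  IsSPow g = ∃ λ (s : Perm) → (∀ v → Inverse.to s v ≈ v * ω) × (g ≃ (s ^ₚ ((2 ℕ.^ d) ℕ.∸ 1)))

  IsPhiPow : Perm → Set (c ⊔ ℓ)
  IsPhiPow g = ∃ λ (φ : Perm) → (∀ v → Inverse.to φ v ≈ v * v) × (g ≃ (φ ^ₚ d))

  Gp : Pred Perm (c ⊔ ℓ)
  Gp = ⟨ (λ g → V g ⊎ IsSPow g ⊎ IsPhiPow g) ⟩

  Ap : Pred Perm (c ⊔ ℓ)
  Ap = ⟨ (λ g → V g ⊎ IsPhiPow g) ⟩

  Hp : Pred Perm (c ⊔ ℓ)
  Hp = ⟨ (λ g → IsR ω g ⊎ IsR (pow F ω (2 ℕ.^ d)) g) ⟩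

  ADoubleCoset : Perm → Pred Perm (c ⊔ ℓ)
  ADoubleCoset g x = ∃ λ a → ∃ λ a′ → Ap a × Ap a′ ×
    ((x ≃ (a · g · a′)) ⊎ (x ≃ (a · g ⁻¹ · a′)))

  EvenIndex : Perm → Set (c ⊔ ℓ)
  EvenIndex g = ∃ λ n → ∃ λ m → ∃ λ k →
    HasSize PermSetoid (ADoubleCoset g) n × HasSize PermSetoid Ap m × n ≡ (2 ℕ.* k) ℕ.* m

-- Write q = n * n with n = 2 ^ d, σ v = v ^ n (= φ ^ d) and ζ = ω ^ (n - 1) (so s ^ (n - 1) is v ↦ v ζ).
-- Every element of G acts as v ↦ a σʲ(v) + u with j ∈ {0, 1} and a ^ (n + 1) = 1; A consists of those
-- with a = 1, and H of the translations by the 𝔽₂-span of ω and ω ^ n = ω ζ.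
-- (a) If g ∉ A has coefficient c, then c ≠ 1, so σ c = c⁻¹ ≠ c as n + 1 is odd. The double coset
-- A{g, g⁻¹}A is then the set of maps with coefficient c or σ c: it has 2 · 2 · q = 2 |A| elements.
-- (b) x₀ = s ^ (n - 1) lies in G and x₀H ⊈ A. If c₀H ⊆ A is adjacent to x₀H, so is c₁H for
-- c₁ = x₀ R(ω) x₀⁻¹ c₀ = R(ω ζ⁻¹) c₀. But c₀⁻¹ c₁ is the translation by σʲ(ω ζ⁻¹) ∈ {ω ζ⁻¹, ω ζ²},
-- which is not in ω · span{1, ζ} because ζ has order n + 1 > 3; so c₀H ≠ c₁H.

module Submission where

open import Defs
open import Level using (Level; _⊔_)
open import Data.Nat as ℕ using (ℕ; zero; suc; _≤_; _<_; z≤n; s≤s)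
import Data.Nat.Properties as ℕ
open import Data.Nat.DivMod using (_%_; _/_; m≡m%n+[m/n]*n; m%n<n)
open import Data.Fin as Fin using (Fin; toℕ; fromℕ<; punchOut)
import Data.Fin.Properties as Fin
open import Data.Bool using (Bool; true; false; _xor_; if_then_else_)
open import Data.Bool.Properties using (xor-assoc; xor-same; xor-identityʳ)
open import Data.Product using (∃; _×_; _,_; proj₁; proj₂)
open import Data.Product.Function.NonDependent.Propositional using (_×-↔_)
open import Data.Sum using (_⊎_; inj₁; inj₂)
open import Data.Empty using (⊥; ⊥-elim)
open import Data.List using (tabulate)
open import Data.List.Properties using (length-tabulate)
import Data.List.Relation.Unary.All.Properties as All
import Data.List.Relation.Unary.Any.Properties as Any
import Data.List.Relation.Unary.Unique.Setoid.Properties as Unique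
open import Function using (_∘_; id; _↔_; Inverse)
open import Function.Properties.Inverse using (↔-trans; ↔-refl; Inverse⇒Injection)
open import Function.Bundles using (Injection)
import Data.List.Membership.Setoid as SetoidMembership
open import Relation.Nullary using (¬_; Dec; yes; no)
open import Relation.Nullary.Decidable using (map′)
open import Relation.Unary using (Pred; _⊆_)
open import Relation.Binary using (Setoid; Decidable)
open import Relation.Binary.PropositionalEquality as ≡ using (_≡_; _≢_)
open import Algebra.Bundles using (CommutativeRing)
open import Algebra.Morphism.Structures using (IsRingHomomorphism)
import Algebra.Morphism.Construct.Identity as Identity
import Algebra.Morphism.Construct.Composition as Composition

module _ {a ℓ} {S : Setoid a ℓ} where
  open SymGroup S

  ⟨⟩-least : ∀ {p q} {T : Pred Perm p} (Q : Pred Perm q) →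
             (∀ {x y} → x ≃ y → Q x → Q y) → Q idp →
             (∀ {x y} → Q x → Q y → Q (x · y)) → (∀ {x} → Q x → Q (x ⁻¹)) →
             T ⊆ Q → ⟨ T ⟩ ⊆ Q
  ⟨⟩-least {T = T} Q resp-Q one-Q mul-Q inv-Q T⊆Q = go
    where
    go : ⟨ T ⟩ ⊆ Q
    go (gen t)    = T⊆Q t
    go one        = one-Q
    go (mul x y)  = mul-Q (go x) (go y)
    go (inv x)    = inv-Q (go x)
    go (resp e x) = resp-Q e (go x)

module _ {a ℓ} (S : Setoid a ℓ) where
  open Setoid S

  HasSize-image : ∀ {p n} {I : Set} {P : Pred Carrier p} → Fin n ↔ I → (f : I → Carrier) →
                  (∀ i → P (f i)) → (∀ {i j} → f i ≈ f j → i ≡ j) →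
                  (∀ x → P x → ∃ λ i → x ≈ f i) → HasSize S P n
  HasSize-image {P = P} e f P-f f-injective f-onto =
    tabulate g , length-tabulate g , All.tabulate⁺ (P-f ∘ to) ,
    Unique.tabulate⁺ S (Injection.injective (Inverse⇒Injection e) ∘ f-injective) , complete
    where
    open Inverse e using (to; from; strictlyInverseˡ)
    open SetoidMembership S using (_∈_)
    g : Fin _ → Carrier
    g = f ∘ to
    complete : ∀ x → P x → x ∈ tabulate g
    complete x Px with f-onto x Px
    ... | i , x≈fi = Any.tabulate⁺ (from i) (trans x≈fi (reflexive (≡.cong f (≡.sym (strictlyInverseˡ i)))))

xor-xor-cancelʳ : ∀ x y z → ((x xor (y xor z)) xor y) xor z ≡ x
xor-xor-cancelʳ x y z = begin
  ((x xor (y xor z)) xor y) xor z   ≡⟨ xor-assoc (x xor (y xor z)) y z ⟩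
  (x xor (y xor z)) xor (y xor z)   ≡⟨ xor-assoc x (y xor z) (y xor z) ⟩
  x xor ((y xor z) xor (y xor z))   ≡⟨ ≡.cong (x xor_) (xor-same (y xor z)) ⟩
  x xor false                       ≡⟨ xor-identityʳ x ⟩
  x                                 ∎
  where open ≡.≡-Reasoning

2*↔Bool× : ∀ {m} {I : Set} → Fin m ↔ I → Fin (2 ℕ.* m) ↔ (Bool × I)
2*↔Bool× Fin-m↔I = ↔-trans Fin.*↔× (Fin.2↔Bool ×-↔ Fin-m↔I)

module RingTheory {c ℓ} (F : CommutativeRing c ℓ) where
  open CommutativeRing F
  open SymGroup setoid
  open import Algebra.Properties.CommutativeSemiring.Exp commutativeSemiring
  open import Algebra.Properties.Group +-group using (//-rightDividesˡ; //-rightDividesʳ) renaming (∙-cancelʳ to +-cancelʳ)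
  open import Algebra.Solver.Ring.NaturalCoefficients.Default commutativeSemiring
  open import Relation.Binary.Reasoning.Setoid setoid

  pow≡^ : ∀ x k → pow F x k ≡ x ^ k
  pow≡^ x zero    = ≡.refl
  pow≡^ x (suc k) = ≡.cong (x *_) (pow≡^ x k)

  ^-zeroˡ : ∀ k → 1# ^ k ≈ 1#
  ^-zeroˡ zero    = refl
  ^-zeroˡ (suc k) = trans (*-identityˡ _) (^-zeroˡ k)

  x²≈1∧x^[1+2m]≈1⇒x≈1 : ∀ {x} m → x * x ≈ 1# → x ^ suc (2 ℕ.* m) ≈ 1# → x ≈ 1#
  x²≈1∧x^[1+2m]≈1⇒x≈1 {x} m x²≈1 x^odd≈1 = begin
    x                   ≈⟨ *-identityʳ x ⟨
    x * 1#              ≈⟨ *-congˡ (^-zeroˡ m) ⟨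
    x * 1# ^ m          ≈⟨ *-congˡ (^-congˡ m x²≈1) ⟨
    x * (x * x) ^ m     ≈⟨ *-congˡ (^-distrib-* x x m) ⟩
    x * (x ^ m * x ^ m) ≈⟨ *-congˡ (^-homo-* x m m) ⟨
    x * x ^ (m ℕ.+ m)   ≡⟨ ≡.cong (λ k → x * x ^ k) (≡.cong (m ℕ.+_) (ℕ.+-identityʳ m)) ⟨
    x ^ suc (2 ℕ.* m)   ≈⟨ x^odd≈1 ⟩
    1#                  ∎

  permutation : (f g : Carrier → Carrier) → (∀ {x y} → x ≈ y → f x ≈ f y) →
                (∀ {x y} → x ≈ y → g x ≈ g y) → (∀ x → f (g x) ≈ x) → (∀ x → g (f x) ≈ x) → Perm
  permutation f g f-cong g-cong fg≈id gf≈id = record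
    { to = f ; from = g ; to-cong = f-cong ; from-cong = g-cong
    ; inverse = (λ {x} y≈gx → trans (f-cong y≈gx) (fg≈id x)) , (λ {x} y≈fx → trans (g-cong y≈fx) (gf≈id x)) }

  translation : Carrier → Perm
  translation u = permutation (_+ u) (_- u) +-congʳ +-congʳ (λ x → //-rightDividesˡ u x) (λ x → //-rightDividesʳ u x)

  scaling : ∀ a a′ → a * a′ ≈ 1# → Perm
  scaling a a′ aa′≈1 =
    permutation (_* a) (_* a′) *-congʳ *-congʳ (cancel a′ a (trans (*-comm a′ a) aa′≈1)) (cancel a a′ aa′≈1)
    where
    cancel : ∀ b b′ → b * b′ ≈ 1# → ∀ x → x * b * b′ ≈ x
    cancel b b′ bb′≈1 x = trans (*-assoc x b b′) (trans (*-congˡ bb′≈1) (*-identityʳ x))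

  scaling-^ₚ : ∀ {s : Perm} {a} → (∀ v → Inverse.to s v ≈ v * a) → ∀ k v → Inverse.to (s ^ₚ k) v ≈ v * a ^ k
  scaling-^ₚ s-to zero    v = sym (*-identityʳ v)
  scaling-^ₚ {s} {a} s-to (suc k) v = begin
    Inverse.to (s ^ₚ k) (Inverse.to s v)   ≈⟨ scaling-^ₚ s-to k _ ⟩
    Inverse.to s v * a ^ k                 ≈⟨ *-congʳ (s-to v) ⟩
    v * a * a ^ k                          ≈⟨ *-assoc v a (a ^ k) ⟩
    v * a ^ suc k                          ∎

  module Field (isField : IsField F) where
    open IsField isField public

    *-cancelˡ-nonZero : ∀ x y z → ¬ x ≈ 0# → x * y ≈ x * z → y ≈ z
    *-cancelˡ-nonZero x y z x≉0 xy≈xz with inverse x x≉0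
    ... | x′ , xx′≈1 = begin
      y              ≈⟨ *-identityˡ y ⟨
      1# * y         ≈⟨ *-congʳ (trans (*-comm x′ x) xx′≈1) ⟨
      x′ * x * y     ≈⟨ *-assoc x′ x y ⟩
      x′ * (x * y)   ≈⟨ *-congˡ xy≈xz ⟩
      x′ * (x * z)   ≈⟨ *-assoc x′ x z ⟨
      x′ * x * z     ≈⟨ *-congʳ (trans (*-comm x′ x) xx′≈1) ⟩
      1# * z         ≈⟨ *-identityˡ z ⟩
      z              ∎

    *-≉0 : ∀ {x y} → ¬ x ≈ 0# → ¬ y ≈ 0# → ¬ x * y ≈ 0#
    *-≉0 {x} {y} x≉0 y≉0 xy≈0 = y≉0 (*-cancelˡ-nonZero x y 0# x≉0 (trans xy≈0 (sym (zeroʳ x))))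

    ^-≉0 : ∀ {x} k → ¬ x ≈ 0# → ¬ x ^ k ≈ 0#
    ^-≉0 zero    x≉0 = 1≉0
    ^-≉0 (suc k) x≉0 = *-≉0 x≉0 (^-≉0 k x≉0)

  module FiniteField (isField : IsField F) {N : ℕ} (card : HasCardinality F (suc N))
                     {ω : Carrier} (ω-generates : IsMultGenerator F ω) where
    open Field isField
    open Inverse card using () renaming (to to element; from to index)
    open import Algebra.Properties.Ring ring using (-1*x≈-x)
    open import Algebra.Properties.Group +-group using (⁻¹-involutive)

    index-injective : ∀ {x y} → index x ≡ index y → x ≈ y
    index-injective {x} {y} eq = begin
      x                 ≈⟨ Inverse.strictlyInverseˡ card x ⟨
      element (index x) ≡⟨ ≡.cong element eq ⟩
      element (index y) ≈⟨ Inverse.strictlyInverseˡ card y ⟩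
      y                 ∎

    _≈?_ : Decidable _≈_
    x ≈? y = map′ index-injective (Inverse.from-cong card) (index x Fin.≟ index y)

    ω≉0 : ¬ ω ≈ 0#
    ω≉0 = proj₁ ω-generates

    log : ∀ x → ¬ x ≈ 0# → ℕ
    log x x≉0 = proj₁ (proj₂ ω-generates x x≉0)

    ω^log : ∀ x x≉0 → x ≈ ω ^ log x x≉0
    ω^log x x≉0 = trans (proj₂ (proj₂ ω-generates x x≉0)) (reflexive (pow≡^ ω (log x x≉0)))

    -- if ω ^ K ≈ 1 then 0 ↦ 0, ω ^ m ↦ 1 + (m mod K) embeds F into Fin (1 + K)
    ω^k≈1⇒N≤k : ∀ {k} → 0 < k → ω ^ k ≈ 1# → N ≤ k
    ω^k≈1⇒N≤k {suc k} _ ω^K≈1 = ℕ.≤-pred (Fin.injective⇒≤ class-injective)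
      where
      K : ℕ
      K = suc k

      ω^[m%K] : ∀ m → ω ^ m ≈ ω ^ (m % K)
      ω^[m%K] m = begin
        ω ^ m                             ≡⟨ ≡.cong (ω ^_) (m≡m%n+[m/n]*n m K) ⟩
        ω ^ (m % K ℕ.+ m / K ℕ.* K)       ≈⟨ ^-homo-* ω (m % K) _ ⟩
        ω ^ (m % K) * ω ^ (m / K ℕ.* K)   ≡⟨ ≡.cong (λ e → ω ^ (m % K) * ω ^ e) (ℕ.*-comm (m / K) K) ⟩
        ω ^ (m % K) * ω ^ (K ℕ.* (m / K)) ≈⟨ *-congˡ (^-assocʳ ω K (m / K)) ⟨
        ω ^ (m % K) * (ω ^ K) ^ (m / K)   ≈⟨ *-congˡ (trans (^-congˡ (m / K) ω^K≈1) (^-zeroˡ (m / K))) ⟩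
        ω ^ (m % K) * 1#                  ≈⟨ *-identityʳ _ ⟩
        ω ^ (m % K)                       ∎

      class : ∀ x → Dec (x ≈ 0#) → Fin (suc K)
      class x (yes _)   = Fin.zero
      class x (no x≉0)  = Fin.suc (fromℕ< (m%n<n (log x x≉0) K))

      class-injective′ : ∀ x y dx dy → class x dx ≡ class y dy → x ≈ y
      class-injective′ x y (yes x≈0) (yes y≈0) _  = trans x≈0 (sym y≈0)
      class-injective′ x y (no x≉0)  (no y≉0)  eq = begin
        x                        ≈⟨ ω^log x x≉0 ⟩
        ω ^ log x x≉0            ≈⟨ ω^[m%K] (log x x≉0) ⟩
        ω ^ (log x x≉0 % K)      ≡⟨ ≡.cong (ω ^_) same-residue ⟩
        ω ^ (log y y≉0 % K)      ≈⟨ ω^[m%K] (log y y≉0) ⟨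
        ω ^ log y y≉0            ≈⟨ ω^log y y≉0 ⟨
        y                        ∎
        where
        same-residue : log x x≉0 % K ≡ log y y≉0 % K
        same-residue = Fin.fromℕ<-injective _ _ (m%n<n (log x x≉0) K) (m%n<n (log y y≉0) K) (Fin.suc-injective eq)
      class-injective′ x y (yes x≈0) (no y≉0)  ()
      class-injective′ x y (no x≉0)  (yes y≈0) ()

      class-injective : ∀ {i j} → class (element i) (element i ≈? 0#) ≡ class (element j) (element j ≈? 0#) → i ≡ j
      class-injective {i} {j} eq = Injection.injective (Inverse⇒Injection card) (class-injective′ _ _ _ _ eq)

    -- pigeonhole on k ↦ ω ^ k (k ≤ N), which misses 0
    ω^N≈1 : ω ^ N ≈ 1#
    ω^N≈1 = collision (Fin.pigeonhole (ℕ.n<1+n N) powerIndex)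
      where
      index0≢index[ω^_] : ∀ k → index 0# ≢ index (ω ^ k)
      index0≢index[ω^_] k eq = ^-≉0 k ω≉0 (sym (index-injective eq))
      powerIndex : Fin (suc N) → Fin N
      powerIndex i = punchOut (index0≢index[ω^ toℕ i ])
      collision : (∃ λ i → ∃ λ j → i Fin.< j × powerIndex i ≡ powerIndex j) → ω ^ N ≈ 1#
      collision (i , j , i<j , eq) = ≡.subst (λ k → ω ^ k ≈ 1#) (ℕ.≤-antisym δ≤N N≤δ) ω^δ≈1
        where
        δ : ℕ
        δ = toℕ j ℕ.∸ toℕ i
        ω^i≈ω^j : ω ^ toℕ i ≈ ω ^ toℕ j
        ω^i≈ω^j = index-injective (Fin.punchOut-injective (index0≢index[ω^ toℕ i ]) (index0≢index[ω^ toℕ j ]) eq)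
        ω^δ≈1 : ω ^ δ ≈ 1#
        ω^δ≈1 = *-cancelˡ-nonZero (ω ^ toℕ i) _ _ (^-≉0 (toℕ i) ω≉0) (begin
          ω ^ toℕ i * ω ^ δ     ≈⟨ ^-homo-* ω (toℕ i) δ ⟨
          ω ^ (toℕ i ℕ.+ δ)     ≡⟨ ≡.cong (ω ^_) (ℕ.m+[n∸m]≡n (ℕ.<⇒≤ i<j)) ⟩
          ω ^ toℕ j             ≈⟨ ω^i≈ω^j ⟨
          ω ^ toℕ i             ≈⟨ *-identityʳ _ ⟨
          ω ^ toℕ i * 1#        ∎)
        δ≤N : δ ≤ N
        δ≤N = ℕ.≤-trans (ℕ.m∸n≤m (toℕ j) (toℕ i)) (ℕ.≤-pred (Fin.toℕ<n j))
        N≤δ : N ≤ δ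
        N≤δ = ω^k≈1⇒N≤k (ℕ.m<n⇒0<n∸m i<j) ω^δ≈1

    ω^[1+N]≈ω : ω ^ suc N ≈ ω
    ω^[1+N]≈ω = trans (*-congˡ ω^N≈1) (*-identityʳ ω)

    x^[1+N]≈x : ∀ x → x ^ suc N ≈ x
    x^[1+N]≈x x with x ≈? 0#
    ... | yes x≈0 = trans (^-congˡ (suc N) x≈0) (trans (zeroˡ _) (sym x≈0))
    ... | no x≉0  = begin
      x ^ suc N             ≈⟨ ^-congˡ (suc N) (ω^log x x≉0) ⟩
      (ω ^ k) ^ suc N       ≈⟨ ^-assocʳ ω k (suc N) ⟩
      ω ^ (k ℕ.* suc N)     ≡⟨ ≡.cong (ω ^_) (ℕ.*-comm k (suc N)) ⟩
      ω ^ (suc N ℕ.* k)     ≈⟨ ^-assocʳ ω (suc N) k ⟨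
      (ω ^ suc N) ^ k       ≈⟨ ^-congˡ k ω^[1+N]≈ω ⟩
      ω ^ k                 ≈⟨ ω^log x x≉0 ⟨
      x                     ∎
      where
      k : ℕ
      k = log x x≉0

    -- -1 is its own (1 + N)-th power, and 1 + N is even
    characteristic2 : ∀ M → suc N ≡ 2 ℕ.* M → 1# + 1# ≈ 0#
    characteristic2 M 1+N≡2M = begin
      1# + 1#      ≈⟨ +-congˡ -1≈1 ⟨
      1# + - 1#    ≈⟨ -‿inverseʳ 1# ⟩
      0#           ∎
      where
      [-1]²≈1 : (- 1#) ^ 2 ≈ 1#
      [-1]²≈1 = begin
        - 1# * (- 1# * 1#)  ≈⟨ *-congˡ (*-identityʳ _) ⟩
        - 1# * - 1#         ≈⟨ -1*x≈-x (- 1#) ⟩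
        - - 1#              ≈⟨ ⁻¹-involutive 1# ⟩
        1#                  ∎
      -1≈1 : - 1# ≈ 1#
      -1≈1 = begin
        - 1#                  ≈⟨ x^[1+N]≈x (- 1#) ⟨
        (- 1#) ^ suc N        ≡⟨ ≡.cong ((- 1#) ^_) 1+N≡2M ⟩
        (- 1#) ^ (2 ℕ.* M)    ≈⟨ ^-assocʳ (- 1#) 2 M ⟨
        ((- 1#) ^ 2) ^ M      ≈⟨ ^-congˡ M [-1]²≈1 ⟩
        1# ^ M                ≈⟨ ^-zeroˡ M ⟩
        1#                    ∎

  module Characteristic2 (1+1≈0 : 1# + 1# ≈ 0#) where
    open import Algebra.Properties.Group +-group using (inverseʳ-unique)

    x+x≈0 : ∀ x → x + x ≈ 0#
    x+x≈0 x = begin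
      x + x             ≈⟨ +-cong (*-identityˡ x) (*-identityˡ x) ⟨
      1# * x + 1# * x   ≈⟨ distribʳ x 1# 1# ⟨
      (1# + 1#) * x     ≈⟨ *-congʳ 1+1≈0 ⟩
      0# * x            ≈⟨ zeroˡ x ⟩
      0#                ∎

    x+y+y≈x : ∀ x y → x + y + y ≈ x
    x+y+y≈x x y = trans (+-assoc x y y) (trans (+-congˡ (x+x≈0 y)) (+-identityʳ x))

    -x≈x : ∀ x → - x ≈ x
    -x≈x x = sym (inverseʳ-unique x x (x+x≈0 x))

    square-+ : ∀ x y → (x + y) * (x + y) ≈ x * x + y * y
    square-+ x y = begin
      (x + y) * (x + y)
        ≈⟨ solve 2 (λ x y → (x :+ y) :* (x :+ y) := (x :* x :+ y :* y) :+ (x :* y :+ x :* y)) refl x y ⟩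
      (x * x + y * y) + (x * y + x * y)  ≈⟨ +-congˡ (x+x≈0 (x * y)) ⟩
      (x * x + y * y) + 0#               ≈⟨ +-identityʳ _ ⟩
      x * x + y * y                      ∎

    square-isRingHomomorphism : IsRingHomomorphism rawRing rawRing (λ x → x * x)
    square-isRingHomomorphism = record
      { isSemiringHomomorphism = record
        { isNearSemiringHomomorphism = record
          { +-isMonoidHomomorphism = record
            { isMagmaHomomorphism = record
              { isRelHomomorphism = record { cong = λ x≈y → *-cong x≈y x≈y }
              ; homo = square-+ }
            ; ε-homo = zeroˡ 0# }
          ; *-homo = λ x y → solve 2 (λ x y → (x :* y) :* (x :* y) := (x :* x) :* (y :* y)) refl x y }
        ; 1#-homo = *-identityˡ 1# }
      ; -‿homo = λ x → trans (*-cong (-x≈x x) (-x≈x x)) (sym (-x≈x (x * x))) }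

    infixl 8 _^2^_
    _^2^_ : Carrier → ℕ → Carrier
    x ^2^ zero  = x
    x ^2^ suc k = (x * x) ^2^ k

    ^2^-isRingHomomorphism : ∀ k → IsRingHomomorphism rawRing rawRing (_^2^ k)
    ^2^-isRingHomomorphism zero    = Identity.isRingHomomorphism rawRing refl
    ^2^-isRingHomomorphism (suc k) =
      Composition.isRingHomomorphism trans square-isRingHomomorphism (^2^-isRingHomomorphism k)

    ^2^-cong : ∀ k {x y} → x ≈ y → x ^2^ k ≈ y ^2^ k
    ^2^-cong k = IsRingHomomorphism.⟦⟧-cong (^2^-isRingHomomorphism k)

    squaring-^ₚ : ∀ {φ : Perm} → (∀ v → Inverse.to φ v ≈ v * v) → ∀ k v → Inverse.to (φ ^ₚ k) v ≈ v ^2^ k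
    squaring-^ₚ φ-to zero    v = refl
    squaring-^ₚ φ-to (suc k) v = trans (squaring-^ₚ φ-to k _) (^2^-cong k (φ-to v))

    ^2^≈^ : ∀ x k → x ^2^ k ≈ x ^ (2 ℕ.^ k)
    ^2^≈^ x zero    = sym (*-identityʳ x)
    ^2^≈^ x (suc k) = begin
      (x * x) ^2^ k                   ≈⟨ ^2^≈^ (x * x) k ⟩
      (x * x) ^ m                     ≈⟨ ^-distrib-* x x m ⟩
      x ^ m * x ^ m                   ≈⟨ ^-homo-* x m m ⟨
      x ^ (m ℕ.+ m)                   ≡⟨ ≡.cong (λ e → x ^ (m ℕ.+ e)) (ℕ.+-identityʳ m) ⟨
      x ^ (2 ℕ.^ suc k)               ∎
      where
      m : ℕ
      m = 2 ℕ.^ k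

  module Semiaffine (isField : IsField F) (σ : Carrier → Carrier)
                    (σ-isRingHomomorphism : IsRingHomomorphism rawRing rawRing σ)
                    (σ-involutive : ∀ x → σ (σ x) ≈ x) where
    open Field isField using (*-cancelˡ-nonZero)
    open Inverse using (to; from)
    open import Algebra.Properties.Ring ring using (x[y-z]≈xy-xz)

    σᵇ : Bool → Carrier → Carrier
    σᵇ false = id
    σᵇ true  = σ

    σᵇ-isRingHomomorphism : ∀ j → IsRingHomomorphism rawRing rawRing (σᵇ j)
    σᵇ-isRingHomomorphism false = Identity.isRingHomomorphism rawRing refl
    σᵇ-isRingHomomorphism true  = σ-isRingHomomorphism

    module σᵇ (j : Bool) = IsRingHomomorphism (σᵇ-isRingHomomorphism j)

    σᵇ-∘ : ∀ i j x → σᵇ i (σᵇ j x) ≈ σᵇ (j xor i) x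
    σᵇ-∘ false false x = refl
    σᵇ-∘ false true  x = refl
    σᵇ-∘ true  false x = refl
    σᵇ-∘ true  true  x = σ-involutive x

    σᵇ-involutive : ∀ j x → σᵇ j (σᵇ j x) ≈ x
    σᵇ-involutive j x = trans (σᵇ-∘ j j x) (reflexive (≡.cong (λ i → σᵇ i x) (xor-same j)))

    record ActsAs (g : Perm) (a : Carrier) (j : Bool) (u : Carrier) : Set (c ⊔ ℓ) where
      constructor actsAs
      field pointwise : ∀ v → to g v ≈ a * σᵇ j v + u
    open ActsAs public

    ActsAs-resp : ∀ {g g′ a j u} → g ≃ g′ → ActsAs g a j u → ActsAs g′ a j u
    ActsAs-resp g≃g′ g-acts = actsAs λ v → trans (sym (g≃g′ v)) (pointwise g-acts v)

    ActsAs-cong : ∀ {g a a′ j j′ u u′} → a ≈ a′ → j ≡ j′ → u ≈ u′ → ActsAs g a j u → ActsAs g a′ j′ u′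
    ActsAs-cong a≈a′ ≡.refl u≈u′ g-acts = actsAs λ v → trans (pointwise g-acts v) (+-cong (*-congʳ a≈a′) u≈u′)

    ActsAs⇒≃ : ∀ {g g′ a j u} → ActsAs g a j u → ActsAs g′ a j u → g ≃ g′
    ActsAs⇒≃ g-acts g′-acts v = trans (pointwise g-acts v) (sym (pointwise g′-acts v))

    idp-actsAs : ActsAs idp 1# false 0#
    idp-actsAs = actsAs λ v → sym (trans (+-identityʳ _) (*-identityˡ v))

    translation-actsAs : ∀ u → ActsAs (translation u) 1# false u
    translation-actsAs u = actsAs λ v → +-congʳ (sym (*-identityˡ v))

    ·-actsAs : ∀ {x y a₁ j₁ u₁ a₂ j₂ u₂} → ActsAs x a₁ j₁ u₁ → ActsAs y a₂ j₂ u₂ →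
               ActsAs (x · y) (a₂ * σᵇ j₂ a₁) (j₁ xor j₂) (a₂ * σᵇ j₂ u₁ + u₂)
    ·-actsAs {x} {y} {a₁} {j₁} {u₁} {a₂} {j₂} {u₂} x-acts y-acts = actsAs λ v → begin
      to y (to x v)                                          ≈⟨ pointwise y-acts (to x v) ⟩
      a₂ * σᵇ j₂ (to x v) + u₂                               ≈⟨ +-congʳ (*-congˡ (σᵇ.⟦⟧-cong j₂ (pointwise x-acts v))) ⟩
      a₂ * σᵇ j₂ (a₁ * σᵇ j₁ v + u₁) + u₂                    ≈⟨ +-congʳ (*-congˡ (σᵇ.+-homo j₂ _ u₁)) ⟩
      a₂ * (σᵇ j₂ (a₁ * σᵇ j₁ v) + σᵇ j₂ u₁) + u₂            ≈⟨ +-congʳ (*-congˡ (+-congʳ (σᵇ.*-homo j₂ a₁ _))) ⟩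
      a₂ * (σᵇ j₂ a₁ * σᵇ j₂ (σᵇ j₁ v) + σᵇ j₂ u₁) + u₂      ≈⟨ +-congʳ (*-congˡ (+-congʳ (*-congˡ (σᵇ-∘ j₂ j₁ v)))) ⟩
      a₂ * (σᵇ j₂ a₁ * σᵇ (j₁ xor j₂) v + σᵇ j₂ u₁) + u₂
        ≈⟨ solve 5 (λ a b s e u → a :* (b :* s :+ e) :+ u := (a :* b) :* s :+ (a :* e :+ u)) refl
             a₂ (σᵇ j₂ a₁) (σᵇ (j₁ xor j₂) v) (σᵇ j₂ u₁) u₂ ⟩
      a₂ * σᵇ j₂ a₁ * σᵇ (j₁ xor j₂) v + (a₂ * σᵇ j₂ u₁ + u₂) ∎

    ⁻¹-actsAs : ∀ {x a a′ j u} → a * a′ ≈ 1# → ActsAs x a j u → ActsAs (x ⁻¹) (σᵇ j a′) j (- σᵇ j (a′ * u))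
    ⁻¹-actsAs {x} {a} {a′} {j} {u} aa′≈1 x-acts = actsAs from-formula
      where
      x-formula : ∀ v → to x (σᵇ j (a′ * (v - u))) ≈ v
      x-formula v = begin
        to x (σᵇ j (a′ * (v - u)))               ≈⟨ pointwise x-acts _ ⟩
        a * σᵇ j (σᵇ j (a′ * (v - u))) + u       ≈⟨ +-congʳ (*-congˡ (σᵇ-involutive j _)) ⟩
        a * (a′ * (v - u)) + u                   ≈⟨ +-congʳ (*-assoc a a′ _) ⟨
        a * a′ * (v - u) + u                     ≈⟨ +-congʳ (trans (*-congʳ aa′≈1) (*-identityˡ _)) ⟩
        v - u + u                                ≈⟨ //-rightDividesˡ u v ⟩
        v                                        ∎
      from-formula : ∀ v → from x v ≈ σᵇ j a′ * σᵇ j v + - σᵇ j (a′ * u)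
      from-formula v = begin
        from x v                                 ≈⟨ Inverse.from-cong x (x-formula v) ⟨
        from x (to x (σᵇ j (a′ * (v - u))))      ≈⟨ Inverse.strictlyInverseʳ x _ ⟩
        σᵇ j (a′ * (v - u))                      ≈⟨ σᵇ.⟦⟧-cong j (x[y-z]≈xy-xz a′ v u) ⟩
        σᵇ j (a′ * v - a′ * u)                   ≈⟨ σᵇ.+-homo j (a′ * v) _ ⟩
        σᵇ j (a′ * v) + σᵇ j (- (a′ * u))        ≈⟨ +-cong (σᵇ.*-homo j a′ v) (σᵇ.-‿homo j (a′ * u)) ⟩
        σᵇ j a′ * σᵇ j v + - σᵇ j (a′ * u)       ∎

    sandwich-actsAs : ∀ {a g a′ j₁ u₁ c jg ug j₂ u₂} → ActsAs a 1# j₁ u₁ → ActsAs g c jg ug → ActsAs a′ 1# j₂ u₂ →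
                      ActsAs (a · g · a′) (σᵇ j₂ c) ((j₁ xor jg) xor j₂) (σᵇ j₂ (c * σᵇ jg u₁ + ug) + u₂)
    sandwich-actsAs {c = c} {jg} {ug} {j₂} {u₂} a-acts g-acts a′-acts =
      ActsAs-cong unit-coefficient ≡.refl (+-congʳ (*-identityˡ _)) (·-actsAs (·-actsAs a-acts g-acts) a′-acts)
      where
      unit-coefficient : 1# * σᵇ j₂ (c * σᵇ jg 1#) ≈ σᵇ j₂ c
      unit-coefficient = trans (*-identityˡ _) (σᵇ.⟦⟧-cong j₂ (trans (*-congˡ (σᵇ.1#-homo jg)) (*-identityʳ c)))

    actsAs-+ : ∀ {g a j u} → ActsAs g a j u → ∀ w t → to g (w + t) ≈ to g w + a * σᵇ j t
    actsAs-+ {g} {a} {j} {u} g-acts w t = begin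
      to g (w + t)                        ≈⟨ pointwise g-acts (w + t) ⟩
      a * σᵇ j (w + t) + u                ≈⟨ +-congʳ (*-congˡ (σᵇ.+-homo j w t)) ⟩
      a * (σᵇ j w + σᵇ j t) + u
        ≈⟨ solve 4 (λ a x y u → a :* (x :+ y) :+ u := (a :* x :+ u) :+ a :* y) refl a (σᵇ j w) (σᵇ j t) u ⟩
      (a * σᵇ j w + u) + a * σᵇ j t       ≈⟨ +-congʳ (pointwise g-acts w) ⟨
      to g w + a * σᵇ j t                 ∎

    actsAs-unique : ∀ {θ g g′ a a′ j j′ u u′} → ¬ σ θ ≈ θ → ¬ a ≈ 0# → g ≃ g′ →
                    ActsAs g a j u → ActsAs g′ a′ j′ u′ → a ≈ a′ × j ≡ j′ × u ≈ u′
    actsAs-unique {θ} {g} {g′} {a} {a′} {j} {j′} {u} {u′} σθ≉θ a≉0 g≃g′ g-acts g′-acts =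
      a≈a′ , twist-unique j j′ σᵇθ≈σᵇθ , u≈u′
      where
      at : ∀ v → a * σᵇ j v + u ≈ a′ * σᵇ j′ v + u′
      at v = trans (sym (pointwise g-acts v)) (trans (g≃g′ v) (pointwise g′-acts v))
      u≈u′ : u ≈ u′
      u≈u′ = begin
        u                     ≈⟨ +-identityˡ u ⟨
        0# + u                ≈⟨ +-congʳ (trans (*-congˡ (σᵇ.0#-homo j)) (zeroʳ a)) ⟨
        a * σᵇ j 0# + u       ≈⟨ at 0# ⟩
        a′ * σᵇ j′ 0# + u′    ≈⟨ +-congʳ (trans (*-congˡ (σᵇ.0#-homo j′)) (zeroʳ a′)) ⟩
        0# + u′               ≈⟨ +-identityˡ u′ ⟩
        u′                    ∎
      linear-part : ∀ v → a * σᵇ j v ≈ a′ * σᵇ j′ v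
      linear-part v = +-cancelʳ u _ _ (trans (at v) (+-congˡ (sym u≈u′)))
      a≈a′ : a ≈ a′
      a≈a′ = begin
        a                ≈⟨ *-identityʳ a ⟨
        a * 1#           ≈⟨ *-congˡ (σᵇ.1#-homo j) ⟨
        a * σᵇ j 1#      ≈⟨ linear-part 1# ⟩
        a′ * σᵇ j′ 1#    ≈⟨ *-congˡ (σᵇ.1#-homo j′) ⟩
        a′ * 1#          ≈⟨ *-identityʳ a′ ⟩
        a′               ∎
      σᵇθ≈σᵇθ : σᵇ j θ ≈ σᵇ j′ θ
      σᵇθ≈σᵇθ = *-cancelˡ-nonZero a _ _ a≉0 (trans (linear-part θ) (*-congʳ (sym a≈a′)))
      twist-unique : ∀ i i′ → σᵇ i θ ≈ σᵇ i′ θ → i ≡ i′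
      twist-unique false false _ = ≡.refl
      twist-unique true  true  _ = ≡.refl
      twist-unique false true  e = ⊥-elim (σθ≉θ (sym e))
      twist-unique true  false e = ⊥-elim (σθ≉θ e)

    record IsσInvariantSubgroup {p} (P : Pred Carrier p) : Set (c ⊔ ℓ ⊔ p) where
      field
        1∈P      : P 1#
        *-closed : ∀ {a b} → P a → P b → P (a * b)
        inverses : ∀ {a} → P a → ∃ λ a′ → P a′ × a * a′ ≈ 1#
        σ-closed : ∀ {a} → P a → P (σ a)

    SemiaffineIn : ∀ {p} → Pred Carrier p → Pred Perm (c ⊔ ℓ ⊔ p)
    SemiaffineIn P g = ∃ λ a → ∃ λ j → ∃ λ u → P a × ActsAs g a j u

    ⟨⟩-semiaffineIn : ∀ {p q} {P : Pred Carrier p} {T : Pred Perm q} →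
                      IsσInvariantSubgroup P → T ⊆ SemiaffineIn P → ⟨ T ⟩ ⊆ SemiaffineIn P
    ⟨⟩-semiaffineIn {P = P} P-subgroup = ⟨⟩-least (SemiaffineIn P) resp-SA one-SA mul-SA inv-SA
      where
      open IsσInvariantSubgroup P-subgroup

      σᵇ-closed : ∀ j {a} → P a → P (σᵇ j a)
      σᵇ-closed false = id
      σᵇ-closed true  = σ-closed

      resp-SA : ∀ {x y} → x ≃ y → SemiaffineIn P x → SemiaffineIn P y
      resp-SA x≃y (a , j , u , Pa , x-acts) = a , j , u , Pa , ActsAs-resp x≃y x-acts

      one-SA : SemiaffineIn P idp
      one-SA = 1# , false , 0# , 1∈P , idp-actsAs

      mul-SA : ∀ {x y} → SemiaffineIn P x → SemiaffineIn P y → SemiaffineIn P (x · y)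
      mul-SA (a₁ , j₁ , u₁ , Pa₁ , x-acts) (a₂ , j₂ , u₂ , Pa₂ , y-acts) =
        _ , _ , _ , *-closed Pa₂ (σᵇ-closed j₂ Pa₁) , ·-actsAs x-acts y-acts

      inv-SA : ∀ {x} → SemiaffineIn P x → SemiaffineIn P (x ⁻¹)
      inv-SA (a , j , u , Pa , x-acts) with inverses Pa
      ... | a′ , Pa′ , aa′≈1 = _ , j , _ , σᵇ-closed j Pa′ , ⁻¹-actsAs aa′≈1 x-acts

module Proposition35 {c ℓ} (F : CommutativeRing c ℓ) (isField : IsField F) (e : ℕ)
                     (card : HasCardinality F (4 ℕ.^ suc (suc e)))
                     (ω : CommutativeRing.Carrier F) (ω-generates : IsMultGenerator F ω) where
  open CommutativeRing F
  open import Algebra.Properties.CommutativeSemiring.Exp commutativeSemiring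
  open import Algebra.Solver.Ring.NaturalCoefficients.Default commutativeSemiring
  open import Algebra.Properties.CommutativeSemigroup +-commutativeSemigroup using () renaming (interchange to +-interchange)

  d : ℕ
  d = suc (suc e)

  open Prop35Setup F d ω
  open Inverse using (to; from; to-cong; from-cong)

  n : ℕ
  n = 2 ℕ.^ d

  n₁ : ℕ
  n₁ = n ℕ.∸ 1

  N : ℕ
  N = n₁ ℕ.* suc n

  4≤n : 4 ≤ n
  4≤n = ℕ.*-monoʳ-≤ 2 (ℕ.*-monoʳ-≤ 2 (ℕ.m^n>0 2 e))

  n≡1+n₁ : n ≡ suc n₁
  n≡1+n₁ = ≡.sym (ℕ.m+[n∸m]≡n (ℕ.≤-trans (s≤s z≤n) 4≤n))

  0<n₁ : 0 < n₁
  0<n₁ = ℕ.m<n⇒0<n∸m (ℕ.≤-trans (s≤s (s≤s z≤n)) 4≤n)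

  n*n≡1+N : n ℕ.* n ≡ suc N
  n*n≡1+N = begin
    n ℕ.* n                ≡⟨ ≡.cong (ℕ._* n) n≡1+n₁ ⟩
    n ℕ.+ n₁ ℕ.* n         ≡⟨ ≡.cong (ℕ._+ n₁ ℕ.* n) n≡1+n₁ ⟩
    suc (n₁ ℕ.+ n₁ ℕ.* n)  ≡⟨ ≡.cong suc (ℕ.*-suc n₁ n) ⟨
    suc N                  ∎
    where open ≡.≡-Reasoning

  q≡1+N : 4 ℕ.^ d ≡ suc N
  q≡1+N = begin
    4 ℕ.^ d                ≡⟨ ℕ.^-*-assoc 2 2 d ⟩
    2 ℕ.^ (2 ℕ.* d)        ≡⟨ ≡.cong (λ m → 2 ℕ.^ (d ℕ.+ m)) (ℕ.+-identityʳ d) ⟩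
    2 ℕ.^ (d ℕ.+ d)        ≡⟨ ℕ.^-distribˡ-+-* 2 d d ⟩
    n ℕ.* n                ≡⟨ n*n≡1+N ⟩
    suc N                  ∎
    where open ≡.≡-Reasoning

  open import Relation.Binary.Reasoning.Setoid setoid
  open RingTheory F
  open Field isField
  F↔Fin : HasCardinality F (suc N)
  F↔Fin = ≡.subst (HasCardinality F) q≡1+N card

  open FiniteField isField F↔Fin ω-generates
  open Inverse F↔Fin using () renaming (to to element; from to index; strictlyInverseˡ to element-index)

  -- The Frobenius involution and ζ

  M : ℕ
  M = 2 ℕ.^ suc e ℕ.* n

  1+N≡2M : suc N ≡ 2 ℕ.* M
  1+N≡2M = ≡.trans (≡.sym n*n≡1+N) (ℕ.*-assoc 2 (2 ℕ.^ suc e) n)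

  1+1≈0 : 1# + 1# ≈ 0#
  1+1≈0 = characteristic2 M 1+N≡2M

  open Characteristic2 1+1≈0

  σ : Carrier → Carrier
  σ x = x ^2^ d

  σ≈^n : ∀ x → σ x ≈ x ^ n
  σ≈^n x = ^2^≈^ x d

  σ-involutive : ∀ x → σ (σ x) ≈ x
  σ-involutive x = begin
    σ (σ x)          ≈⟨ σ≈^n (σ x) ⟩
    σ x ^ n          ≈⟨ ^-congˡ n (σ≈^n x) ⟩
    (x ^ n) ^ n      ≈⟨ ^-assocʳ x n n ⟩
    x ^ (n ℕ.* n)    ≡⟨ ≡.cong (x ^_) n*n≡1+N ⟩
    x ^ suc N        ≈⟨ x^[1+N]≈x x ⟩
    x                ∎

  open Semiaffine isField σ (^2^-isRingHomomorphism d) σ-involutive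
  module σ = IsRingHomomorphism (^2^-isRingHomomorphism d)

  ζ : Carrier
  ζ = ω ^ n₁

  ζ≉0 : ¬ ζ ≈ 0#
  ζ≉0 = ^-≉0 n₁ ω≉0

  ζ^[1+n]≈1 : ζ ^ suc n ≈ 1#
  ζ^[1+n]≈1 = trans (^-assocʳ ω n₁ (suc n)) ω^N≈1

  ζ^k≉1 : ∀ k → 0 < k → k ≤ n → ¬ ζ ^ k ≈ 1#
  ζ^k≉1 (suc k) _ 1+k≤n ζ^k≈1 =
    ℕ.<⇒≱ n₁k<N (ω^k≈1⇒N≤k (ℕ.<-≤-trans 0<n₁ (ℕ.m≤m*n n₁ (suc k))) (trans (sym (^-assocʳ ω n₁ (suc k))) ζ^k≈1))
    where
    n₁k<N : n₁ ℕ.* suc k < N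
    n₁k<N = ℕ.*-monoʳ-< n₁ {{ℕ.>-nonZero 0<n₁}} (s≤s 1+k≤n)

  ζ≉1 : ¬ ζ ≈ 1#
  ζ≉1 ζ≈1 = ζ^k≉1 1 (s≤s z≤n) (ℕ.≤-trans (s≤s z≤n) 4≤n) (trans (*-identityʳ ζ) ζ≈1)

  ζ²≉1 : ¬ ζ * ζ ≈ 1#
  ζ²≉1 ζ²≈1 = ζ^k≉1 2 (s≤s z≤n) (ℕ.≤-trans (s≤s (s≤s z≤n)) 4≤n) (trans (*-congˡ (*-identityʳ ζ)) ζ²≈1)

  ζ²≉1+ζ : ¬ ζ * ζ ≈ 1# + ζ
  ζ²≉1+ζ ζ²≈1+ζ = ζ^k≉1 3 (s≤s z≤n) (ℕ.≤-trans (s≤s (s≤s (s≤s z≤n))) 4≤n) (begin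
    ζ * (ζ * (ζ * 1#))   ≈⟨ *-congˡ (*-congˡ (*-identityʳ ζ)) ⟩
    ζ * (ζ * ζ)          ≈⟨ *-congˡ ζ²≈1+ζ ⟩
    ζ * (1# + ζ)         ≈⟨ distribˡ ζ 1# ζ ⟩
    ζ * 1# + ζ * ζ       ≈⟨ +-cong (*-identityʳ ζ) ζ²≈1+ζ ⟩
    ζ + (1# + ζ)         ≈⟨ +-comm ζ _ ⟩
    (1# + ζ) + ζ         ≈⟨ x+y+y≈x 1# ζ ⟩
    1#                   ∎)

  σω≈ωζ : σ ω ≈ ω * ζ
  σω≈ωζ = trans (σ≈^n ω) (reflexive (≡.cong (ω ^_) n≡1+n₁))

  σω≉ω : ¬ σ ω ≈ ω
  σω≉ω σω≈ω = ζ≉1 (*-cancelˡ-nonZero ω ζ 1# ω≉0 (trans (sym σω≈ωζ) (trans σω≈ω (sym (*-identityʳ ω)))))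

  σ[ζ^n]≈ζ : σ (ζ ^ n) ≈ ζ
  σ[ζ^n]≈ζ = trans (σ.⟦⟧-cong (sym (σ≈^n ζ))) (σ-involutive ζ)

  -- G, A and H as groups of semiaffine maps

  Norm1 : Pred Carrier ℓ
  Norm1 a = a ^ suc n ≈ 1#

  Norm1-^ : ∀ {a} → Norm1 a → ∀ k → Norm1 (a ^ k)
  Norm1-^ {a} a^[1+n]≈1 k = begin
    (a ^ k) ^ suc n       ≈⟨ ^-assocʳ a k (suc n) ⟩
    a ^ (k ℕ.* suc n)     ≡⟨ ≡.cong (a ^_) (ℕ.*-comm k (suc n)) ⟩
    a ^ (suc n ℕ.* k)     ≈⟨ ^-assocʳ a (suc n) k ⟨
    (a ^ suc n) ^ k       ≈⟨ ^-congˡ k a^[1+n]≈1 ⟩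
    1# ^ k                ≈⟨ ^-zeroˡ k ⟩
    1#                    ∎

  Norm1-*σ : ∀ {a} → Norm1 a → a * σ a ≈ 1#
  Norm1-*σ a^[1+n]≈1 = trans (*-congˡ (σ≈^n _)) a^[1+n]≈1

  Norm1-isσInvariantSubgroup : IsσInvariantSubgroup Norm1
  Norm1-isσInvariantSubgroup = record
    { 1∈P      = ^-zeroˡ (suc n)
    ; *-closed = λ {a} {b} a∈ b∈ → trans (^-distrib-* a b (suc n)) (trans (*-cong a∈ b∈) (*-identityˡ 1#))
    ; inverses = λ {a} a∈ → a ^ n , Norm1-^ a∈ n , a∈
    ; σ-closed = λ {a} a∈ → trans (^-congˡ (suc n) (σ≈^n a)) (Norm1-^ a∈ n)
    }

  Unit-isσInvariantSubgroup : IsσInvariantSubgroup (_≈ 1#)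
  Unit-isσInvariantSubgroup = record
    { 1∈P      = refl
    ; *-closed = λ a≈1 b≈1 → trans (*-cong a≈1 b≈1) (*-identityˡ 1#)
    ; inverses = λ {a} a≈1 → 1# , refl , trans (*-identityʳ a) a≈1
    ; σ-closed = λ a≈1 → trans (σ.⟦⟧-cong a≈1) σ.1#-homo
    }

  IsR⇒actsAs : ∀ {u g} → IsR u g → ActsAs g 1# false u
  IsR⇒actsAs g-to = actsAs λ v → trans (g-to v) (+-congʳ (sym (*-identityˡ v)))

  IsPhiPow⇒actsAs : ∀ {g} → IsPhiPow g → ActsAs g 1# true 0#
  IsPhiPow⇒actsAs (φ , φ-to , g≃φ^d) = actsAs λ v →
    trans (g≃φ^d v) (trans (squaring-^ₚ φ-to d v) (sym (trans (+-identityʳ _) (*-identityˡ _))))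

  IsSPow⇒actsAs : ∀ {g} → IsSPow g → ActsAs g ζ false 0#
  IsSPow⇒actsAs (s , s-to , g≃s^n₁) = actsAs λ v →
    trans (g≃s^n₁ v) (trans (scaling-^ₚ s-to n₁ v) (sym (trans (+-identityʳ _) (*-comm ζ v))))

  G-semiaffine : Gp ⊆ SemiaffineIn Norm1
  G-semiaffine = ⟨⟩-semiaffineIn Norm1-isσInvariantSubgroup generator
    where
    generator : ∀ {g} → V g ⊎ IsSPow g ⊎ IsPhiPow g → SemiaffineIn Norm1 g
    generator (inj₁ (u , g-to))  = 1# , false , u , ^-zeroˡ (suc n) , IsR⇒actsAs g-to
    generator (inj₂ (inj₁ g-s))  = ζ , false , 0# , ζ^[1+n]≈1 , IsSPow⇒actsAs g-s
    generator (inj₂ (inj₂ g-φ))  = 1# , true , 0# , ^-zeroˡ (suc n) , IsPhiPow⇒actsAs g-φ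

  A-semiaffine : Ap ⊆ SemiaffineIn (_≈ 1#)
  A-semiaffine = ⟨⟩-semiaffineIn Unit-isσInvariantSubgroup generator
    where
    generator : ∀ {g} → V g ⊎ IsPhiPow g → SemiaffineIn (_≈ 1#) g
    generator (inj₁ (u , g-to)) = 1# , false , u , refl , IsR⇒actsAs g-to
    generator (inj₂ g-φ)        = 1# , true , 0# , refl , IsPhiPow⇒actsAs g-φ

  A-actsAs : ∀ {a} → Ap a → ∃ λ j → ∃ λ u → ActsAs a 1# j u
  A-actsAs a∈A = let (_ , j , u , α≈1 , a-acts) = A-semiaffine a∈A in j , u , ActsAs-cong α≈1 ≡.refl refl a-acts

  bit : Bool → Carrier → Carrier
  bit a x = if a then x else 0#

  bit-xor : ∀ a a′ x → bit a x + bit a′ x ≈ bit (a xor a′) x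
  bit-xor false false x = +-identityʳ 0#
  bit-xor false true  x = +-identityˡ x
  bit-xor true  false x = +-identityʳ x
  bit-xor true  true  x = x+x≈0 x

  span₂ : Bool → Bool → Carrier
  span₂ a b = bit a 1# + bit b ζ

  span₂-+ : ∀ a b a′ b′ → span₂ a b + span₂ a′ b′ ≈ span₂ (a xor a′) (b xor b′)
  span₂-+ a b a′ b′ = begin
    (bit a 1# + bit b ζ) + (bit a′ 1# + bit b′ ζ)   ≈⟨ +-interchange (bit a 1#) (bit b ζ) (bit a′ 1#) (bit b′ ζ) ⟩
    (bit a 1# + bit a′ 1#) + (bit b ζ + bit b′ ζ)   ≈⟨ +-cong (bit-xor a a′ 1#) (bit-xor b b′ ζ) ⟩
    span₂ (a xor a′) (b xor b′)                     ∎

  TranslationInωSpan : Pred Perm (c ⊔ ℓ)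
  TranslationInωSpan h = ∃ λ a → ∃ λ b → ActsAs h 1# false (ω * span₂ a b)

  H-translation : Hp ⊆ TranslationInωSpan
  H-translation = ⟨⟩-least TranslationInωSpan resp-T one-T mul-T inv-T generator
    where
    resp-T : ∀ {x y} → x ≃ y → TranslationInωSpan x → TranslationInωSpan y
    resp-T x≃y (a , b , x-acts) = a , b , ActsAs-resp x≃y x-acts

    one-T : TranslationInωSpan idp
    one-T = false , false , ActsAs-cong refl ≡.refl ω*0≈0 idp-actsAs
      where
      ω*0≈0 : 0# ≈ ω * span₂ false false
      ω*0≈0 = sym (trans (*-congˡ (+-identityʳ 0#)) (zeroʳ ω))

    mul-T : ∀ {x y} → TranslationInωSpan x → TranslationInωSpan y → TranslationInωSpan (x · y)
    mul-T (a , b , x-acts) (a′ , b′ , y-acts) =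
      a xor a′ , b xor b′ , ActsAs-cong (*-identityˡ 1#) ≡.refl shift (·-actsAs x-acts y-acts)
      where
      shift : 1# * (ω * span₂ a b) + ω * span₂ a′ b′ ≈ ω * span₂ (a xor a′) (b xor b′)
      shift = begin
        1# * (ω * span₂ a b) + ω * span₂ a′ b′   ≈⟨ +-congʳ (*-identityˡ _) ⟩
        ω * span₂ a b + ω * span₂ a′ b′         ≈⟨ distribˡ ω _ _ ⟨
        ω * (span₂ a b + span₂ a′ b′)           ≈⟨ *-congˡ (span₂-+ a b a′ b′) ⟩
        ω * span₂ (a xor a′) (b xor b′)         ∎

    inv-T : ∀ {x} → TranslationInωSpan x → TranslationInωSpan (x ⁻¹)
    inv-T (a , b , x-acts) =
      a , b , ActsAs-cong refl ≡.refl (trans (-x≈x _) (*-identityˡ _)) (⁻¹-actsAs (*-identityˡ 1#) x-acts)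

    generator : ∀ {h} → IsR ω h ⊎ IsR (pow F ω n) h → TranslationInωSpan h
    generator {h} (inj₁ h-to) = true , false , ActsAs-cong refl ≡.refl ω≈ω*[1+0] (IsR⇒actsAs {g = h} h-to)
      where
      ω≈ω*[1+0] : ω ≈ ω * span₂ true false
      ω≈ω*[1+0] = sym (trans (*-congˡ (+-identityʳ 1#)) (*-identityʳ ω))
    generator {h} (inj₂ h-to) = false , true , ActsAs-cong refl ≡.refl ω^n≈ω*[0+ζ] (IsR⇒actsAs {g = h} h-to)
      where
      ω^n≈ω*[0+ζ] : pow F ω n ≈ ω * span₂ false true
      ω^n≈ω*[0+ζ] = begin
        pow F ω n                ≡⟨ pow≡^ ω n ⟩
        ω ^ n                    ≈⟨ trans (sym (σ≈^n ω)) σω≈ωζ ⟩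
        ω * ζ                    ≈⟨ *-congˡ (+-identityˡ ζ) ⟨
        ω * span₂ false true     ∎

  -- A second codeword adjacent to x₀H

  s : Perm
  s = scaling ω (proj₁ (inverse ω ω≉0)) (proj₂ (inverse ω ω≉0))

  x₀ : Perm
  x₀ = s ^ₚ n₁

  x₀-isSPow : IsSPow x₀
  x₀-isSPow = s , (λ v → refl) , (λ v → refl)

  x₀∈G : Gp x₀
  x₀∈G = gen (inj₂ (inj₁ x₀-isSPow))

  x₀-actsAs : ActsAs x₀ ζ false 0#
  x₀-actsAs = IsSPow⇒actsAs x₀-isSPow

  R∈A : ∀ u → Ap (translation u)
  R∈A u = gen (inj₁ (u , λ v → refl))

  R∈G : ∀ u → Gp (translation u)
  R∈G u = gen (inj₁ (u , λ v → refl))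

  R[ω]∈H : Hp (translation ω)
  R[ω]∈H = gen (inj₁ (λ v → refl))

  CosetInA⇒A : ∀ {x} → CosetInA Gp Hp Ap x → Ap x
  CosetInA⇒A xH⊆A = resp (λ v → refl) (xH⊆A idp one)

  x₀∉A : ¬ Ap x₀
  x₀∉A x₀∈A = excluded (A-actsAs x₀∈A)
    where
    excluded : (∃ λ j → ∃ λ u → ActsAs x₀ 1# j u) → ⊥
    excluded (j , u , x₀-acts′) = ζ≉1 (proj₁ (actsAs-unique σω≉ω ζ≉0 (λ v → refl) x₀-actsAs x₀-acts′))

  x₀H⊈A : ¬ CosetInA Gp Hp Ap x₀
  x₀H⊈A = x₀∉A ∘ CosetInA⇒A

  t : Carrier
  t = ω * ζ ^ n

  x₀R[ω]x₀⁻¹≃R[t] : (x₀ · translation ω · x₀ ⁻¹) ≃ translation t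
  x₀R[ω]x₀⁻¹≃R[t] v = begin
    from x₀ (to x₀ v + ω)             ≈⟨ from-cong x₀ x₀[v+t]≈x₀[v]+ω ⟨
    from x₀ (to x₀ (v + t))           ≈⟨ Inverse.strictlyInverseʳ x₀ (v + t) ⟩
    v + t                             ∎
    where
    x₀[v+t]≈x₀[v]+ω : to x₀ (v + t) ≈ to x₀ v + ω
    x₀[v+t]≈x₀[v]+ω = begin
      to x₀ (v + t)                   ≈⟨ actsAs-+ x₀-actsAs v t ⟩
      to x₀ v + ζ * (ω * ζ ^ n)       ≈⟨ +-congˡ (solve 3 (λ z w y → z :* (w :* y) := w :* (z :* y)) refl ζ ω (ζ ^ n)) ⟩
      to x₀ v + ω * ζ ^ suc n         ≈⟨ +-congˡ (trans (*-congˡ ζ^[1+n]≈1) (*-identityʳ ω)) ⟩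
      to x₀ v + ω                     ∎

  ζ^n∉span₂ : ∀ a b → ¬ ζ ^ n ≈ span₂ a b
  ζ^n∉span₂ a b ζ^n≈s = excluded a b (trans (sym ζ^[1+n]≈1) (*-congˡ ζ^n≈s))
    where
    excluded : ∀ a b → ¬ 1# ≈ ζ * span₂ a b
    excluded false false 1≈ζs = 1≉0 (trans 1≈ζs (trans (*-congˡ (+-identityʳ 0#)) (zeroʳ ζ)))
    excluded true  false 1≈ζs = ζ≉1 (sym (trans 1≈ζs (trans (*-congˡ (+-identityʳ 1#)) (*-identityʳ ζ))))
    excluded false true  1≈ζs = ζ²≉1 (sym (trans 1≈ζs (*-congˡ (+-identityˡ ζ))))
    excluded true  true  1≈ζs = ζ²≉1+ζ (begin
      ζ * ζ                 ≈⟨ x+y+y≈x (ζ * ζ) ζ ⟨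
      ζ * ζ + ζ + ζ         ≈⟨ +-congʳ (+-comm (ζ * ζ) ζ) ⟩
      ζ + ζ * ζ + ζ         ≈⟨ +-congʳ (+-congʳ (*-identityʳ ζ)) ⟨
      ζ * 1# + ζ * ζ + ζ    ≈⟨ +-congʳ (distribˡ ζ 1# ζ) ⟨
      ζ * (1# + ζ) + ζ      ≈⟨ +-congʳ 1≈ζs ⟨
      1# + ζ                ∎)

  ζ²∉span₂ : ∀ a b → ¬ ζ * ζ ≈ span₂ a b
  ζ²∉span₂ false false ζ²≈s = *-≉0 ζ≉0 ζ≉0 (trans ζ²≈s (+-identityʳ 0#))
  ζ²∉span₂ true  false ζ²≈s = ζ²≉1 (trans ζ²≈s (+-identityʳ 1#))
  ζ²∉span₂ false true  ζ²≈s = ζ≉1 (*-cancelˡ-nonZero ζ ζ 1# ζ≉0 (trans ζ²≈s (trans (+-identityˡ ζ) (sym (*-identityʳ ζ)))))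
  ζ²∉span₂ true  true  ζ²≈s = ζ²≉1+ζ ζ²≈s

  σᵇt∉ωspan₂ : ∀ j a b → ¬ σᵇ j t ≈ ω * span₂ a b
  σᵇt∉ωspan₂ false a b t≈ωs = ζ^n∉span₂ a b (*-cancelˡ-nonZero ω _ _ ω≉0 t≈ωs)
  σᵇt∉ωspan₂ true  a b σt≈ωs = ζ²∉span₂ a b (*-cancelˡ-nonZero ω _ _ ω≉0 (begin
    ω * (ζ * ζ)           ≈⟨ *-assoc ω ζ ζ ⟨
    ω * ζ * ζ             ≈⟨ *-cong σω≈ωζ σ[ζ^n]≈ζ ⟨
    σ ω * σ (ζ ^ n)       ≈⟨ σ.*-homo ω (ζ ^ n) ⟨
    σ t                   ≈⟨ σt≈ωs ⟩
    ω * span₂ a b         ∎))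

  -- an element of A acting as v ↦ σᵇ j v + u conjugates R(t) into R(σᵇ j t)
  R[t]-conjugate∉H : ∀ {a} → Ap a → ¬ Hp (a ⁻¹ · translation t · a)
  R[t]-conjugate∉H {a} a∈A conj∈H = excluded (A-actsAs a∈A) (H-translation conj∈H)
    where
    excluded : (∃ λ j → ∃ λ u → ActsAs a 1# j u) → TranslationInωSpan (a ⁻¹ · translation t · a) → ⊥
    excluded (j , _ , a-acts) (b₁ , b₂ , conj-acts) = σᵇt∉ωspan₂ j b₁ b₂ (begin
      σᵇ j t                                  ≈⟨ +-identityˡ _ ⟨
      0# + σᵇ j t                             ≈⟨ +-cong (Inverse.strictlyInverseˡ a 0#) (*-identityˡ _) ⟨
      to a w + 1# * σᵇ j t                    ≈⟨ actsAs-+ a-acts w t ⟨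
      to a (w + t)                            ≈⟨ pointwise conj-acts 0# ⟩
      1# * 0# + ω * span₂ b₁ b₂               ≈⟨ +-congʳ (zeroʳ 1#) ⟩
      0# + ω * span₂ b₁ b₂                    ≈⟨ +-identityˡ _ ⟩
      ω * span₂ b₁ b₂                         ∎)
      where
      w : Carrier
      w = from a 0#

  second-codeword : ∀ {U c₀} → Gp c₀ → CosetInA Gp Hp Ap c₀ → Adj Gp Hp Ap U x₀ c₀ →
                    ∃ λ c₁ → Gp c₁ × CosetInA Gp Hp Ap c₁ × Adj Gp Hp Ap U x₀ c₁ × ¬ SameCoset Gp Hp Ap c₀ c₁
  second-codeword {U} {c₀} c₀∈G c₀H⊆A (h₁ , u₀ , h₂ , h₁∈H , u₀∈U , h₂∈H , x₀⁻¹c₀≃h₁u₀h₂) =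
    c₁ , c₁∈G , c₁H⊆A , adjacent , c₀H≢c₁H
    where
    c₁ : Perm
    c₁ = x₀ · translation ω · x₀ ⁻¹ · c₀

    c₁≃R[t]c₀ : c₁ ≃ (translation t · c₀)
    c₁≃R[t]c₀ v = to-cong c₀ (x₀R[ω]x₀⁻¹≃R[t] v)

    c₁∈G : Gp c₁
    c₁∈G = mul (mul (mul x₀∈G (R∈G ω)) (inv x₀∈G)) c₀∈G

    c₁H⊆A : CosetInA Gp Hp Ap c₁
    c₁H⊆A h h∈H = resp (λ v → to-cong h (sym (c₁≃R[t]c₀ v))) (mul (R∈A t) (c₀H⊆A h h∈H))

    adjacent : Adj Gp Hp Ap U x₀ c₁
    adjacent = translation ω · h₁ , u₀ , h₂ , mul R[ω]∈H h₁∈H , u₀∈U , h₂∈H ,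
      λ v → trans (to-cong c₀ (from-cong x₀ (+-congʳ (Inverse.strictlyInverseˡ x₀ v)))) (x₀⁻¹c₀≃h₁u₀h₂ (v + ω))

    c₀H≢c₁H : ¬ SameCoset Gp Hp Ap c₀ c₁
    c₀H≢c₁H c₀⁻¹c₁∈H = R[t]-conjugate∉H (CosetInA⇒A {c₀} c₀H⊆A) (resp (λ v → c₁≃R[t]c₀ (from c₀ v)) c₀⁻¹c₁∈H)

  A-not-perfect : ¬ IsPerfectCodeOfPair Gp Hp Ap
  A-not-perfect (U , _ , _ , perfect) =
    let ((c₀ , c₀∈G , c₀H⊆A , adjacent₀) , unique) = perfect x₀ x₀∈G x₀H⊈A
        (c₁ , c₁∈G , c₁H⊆A , adjacent₁ , c₀H≢c₁H)  = second-codeword c₀∈G c₀H⊆A adjacent₀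
    in c₀H≢c₁H (unique c₀ c₁ c₀∈G c₁∈G c₀H⊆A c₁H⊆A adjacent₀ adjacent₁)

  -- Counting A and A{g, g⁻¹}A

  element-injective : ∀ {i j} → element i ≈ element j → i ≡ j
  element-injective = Injection.injective (Inverse⇒Injection F↔Fin)

  squaring : Perm
  squaring = permutation (λ x → x * x) (_^ M) (λ x≈y → *-cong x≈y x≈y) (^-congˡ M) x^M*x^M≈x
               (λ x → trans (^-distrib-* x x M) (x^M*x^M≈x x))
    where
    x^M*x^M≈x : ∀ x → x ^ M * x ^ M ≈ x
    x^M*x^M≈x x = begin
      x ^ M * x ^ M       ≈⟨ ^-homo-* x M M ⟨
      x ^ (M ℕ.+ M)       ≡⟨ ≡.cong (λ k → x ^ (M ℕ.+ k)) (ℕ.+-identityʳ M) ⟨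
      x ^ (2 ℕ.* M)       ≡⟨ ≡.cong (x ^_) 1+N≡2M ⟨
      x ^ suc N           ≈⟨ x^[1+N]≈x x ⟩
      x                   ∎

  σᵇ-perm : Bool → Perm
  σᵇ-perm false = idp
  σᵇ-perm true  = squaring ^ₚ d

  σᵇ-perm-actsAs : ∀ j → ActsAs (σᵇ-perm j) 1# j 0#
  σᵇ-perm-actsAs false = idp-actsAs
  σᵇ-perm-actsAs true  = IsPhiPow⇒actsAs (squaring , (λ v → refl) , (λ v → refl))

  σᵇ-perm∈A : ∀ j → Ap (σᵇ-perm j)
  σᵇ-perm∈A false = one
  σᵇ-perm∈A true  = gen (inj₂ (squaring , (λ v → refl) , (λ v → refl)))

  A-element : Bool × Fin (suc N) → Perm
  A-element (j , i) = σᵇ-perm j · translation (element i)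

  A-element∈A : ∀ p → Ap (A-element p)
  A-element∈A (j , i) = mul (σᵇ-perm∈A j) (R∈A (element i))

  A-element-actsAs : ∀ j i → ActsAs (A-element (j , i)) 1# j (element i)
  A-element-actsAs j i = ActsAs-cong (*-identityˡ 1#) (xor-identityʳ j)
    (trans (+-congʳ (zeroʳ 1#)) (+-identityˡ _)) (·-actsAs (σᵇ-perm-actsAs j) (translation-actsAs (element i)))

  A-element-onto : ∀ {x j u} → ActsAs x 1# j u → x ≃ A-element (j , index u)
  A-element-onto {j = j} {u} x-acts =
    ActsAs⇒≃ x-acts (ActsAs-cong refl ≡.refl (element-index u) (A-element-actsAs j (index u)))

  A-element-injective : ∀ {p p′} → A-element p ≃ A-element p′ → p ≡ p′
  A-element-injective {j , i} {j′ , i′} eq =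
    let (_ , j≡j′ , i≈i′) = actsAs-unique σω≉ω 1≉0 eq (A-element-actsAs j i) (A-element-actsAs j′ i′)
    in ≡.cong₂ _,_ j≡j′ (element-injective i≈i′)

  A-size : HasSize PermSetoid Ap (2 ℕ.* suc N)
  A-size = HasSize-image PermSetoid (2*↔Bool× ↔-refl) A-element A-element∈A A-element-injective onto
    where
    onto : ∀ x → Ap x → ∃ λ p → x ≃ A-element p
    onto x x∈A = let (j , u , x-acts) = A-actsAs x∈A in (j , index u) , A-element-onto x-acts

  module DoubleCoset {g c jg ug} (c∈Norm1 : Norm1 c) (g-acts : ActsAs g c jg ug) (g∉A : ¬ Ap g) where
    open import Algebra.Properties.Group +-group using (//-rightDividesˡ) renaming (∙-cancelˡ to +-cancelˡ)

    c≉1 : ¬ c ≈ 1#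
    c≉1 c≈1 = g∉A (resp (λ v → sym (g≃A-element v)) (A-element∈A (jg , index ug)))
      where
      g≃A-element : g ≃ A-element (jg , index ug)
      g≃A-element = A-element-onto (ActsAs-cong c≈1 ≡.refl refl g-acts)

    -- c ^ (1 + n) ≈ 1 with 1 + n odd, so c * c ≈ 1 would force c ≈ 1
    c≉σc : ¬ c ≈ σ c
    c≉σc c≈σc = c≉1 (x²≈1∧x^[1+2m]≈1⇒x≈1 (2 ℕ.^ suc e) (trans (*-congˡ c≈σc) (Norm1-*σ c∈Norm1)) c∈Norm1)

    σᵇc≉0 : ∀ b → ¬ σᵇ b c ≈ 0#
    σᵇc≉0 false c≈0  = 1≉0 (trans (sym (Norm1-*σ c∈Norm1)) (trans (*-congʳ c≈0) (zeroˡ _)))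
    σᵇc≉0 true  σc≈0 = 1≉0 (trans (sym (Norm1-*σ c∈Norm1)) (trans (*-congˡ σc≈0) (zeroʳ _)))

    σᵇc-injective : ∀ b b′ → σᵇ b c ≈ σᵇ b′ c → b ≡ b′
    σᵇc-injective false false _ = ≡.refl
    σᵇc-injective true  true  _ = ≡.refl
    σᵇc-injective false true  e = ⊥-elim (c≉σc e)
    σᵇc-injective true  false e = ⊥-elim (c≉σc (sym e))

    g⁻¹-actsAs : ActsAs (g ⁻¹) (σᵇ (true xor jg) c) jg (- σᵇ jg (σ c * ug))
    g⁻¹-actsAs = ActsAs-cong (σᵇ-∘ jg true c) ≡.refl refl (⁻¹-actsAs (Norm1-*σ c∈Norm1) g-acts)

    D-form : ∀ {x} → ADoubleCoset g x → ∃ λ b → ∃ λ j → ∃ λ u → ActsAs x (σᵇ b c) j u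
    D-form {x} (a , a′ , a∈A , a′∈A , x∈AgA) = sandwiched (A-actsAs a∈A) (A-actsAs a′∈A) x∈AgA
      where
      sandwiched : (∃ λ j → ∃ λ u → ActsAs a 1# j u) → (∃ λ j → ∃ λ u → ActsAs a′ 1# j u) →
                   (x ≃ (a · g · a′)) ⊎ (x ≃ (a · g ⁻¹ · a′)) → ∃ λ b → ∃ λ j → ∃ λ u → ActsAs x (σᵇ b c) j u
      sandwiched (_ , _ , a-acts) (j₂ , _ , a′-acts) (inj₁ x≃aga′) =
        j₂ , _ , _ , ActsAs-resp (λ v → sym (x≃aga′ v)) (sandwich-actsAs a-acts g-acts a′-acts)
      sandwiched (_ , _ , a-acts) (j₂ , _ , a′-acts) (inj₂ x≃ag⁻¹a′) =
        (true xor jg) xor j₂ , _ , _ , ActsAs-resp (λ v → sym (x≃ag⁻¹a′ v))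
          (ActsAs-cong (σᵇ-∘ j₂ (true xor jg) c) ≡.refl refl (sandwich-actsAs a-acts g⁻¹-actsAs a′-acts))

    shift : Bool → Carrier
    shift b = σᵇ b (c * σᵇ jg 0# + ug)

    D-element : Bool × Bool × Fin (suc N) → Perm
    D-element (b , j , i) = σᵇ-perm (j xor (jg xor b)) · g · A-element (b , i)

    D-element∈D : ∀ p → ADoubleCoset g (D-element p)
    D-element∈D (b , j , i) =
      σᵇ-perm (j xor (jg xor b)) , A-element (b , i) , σᵇ-perm∈A (j xor (jg xor b)) , A-element∈A (b , i) , inj₁ (λ v → refl)

    D-element-actsAs : ∀ b j i → ActsAs (D-element (b , j , i)) (σᵇ b c) j (shift b + element i)
    D-element-actsAs b j i = ActsAs-cong refl (xor-xor-cancelʳ j jg b) refl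
      (sandwich-actsAs (σᵇ-perm-actsAs (j xor (jg xor b))) g-acts (A-element-actsAs b i))

    D-element-injective : ∀ {p p′} → D-element p ≃ D-element p′ → p ≡ p′
    D-element-injective {b , j , i} {b′ , j′ , i′} eq =
      let (σᵇc≈σᵇ′c , j≡j′ , shifts≈) =
            actsAs-unique σω≉ω (σᵇc≉0 b) eq (D-element-actsAs b j i) (D-element-actsAs b′ j′ i′)
      in same-index (σᵇc-injective b b′ σᵇc≈σᵇ′c) j≡j′ shifts≈
      where
      same-index : ∀ {b b′ j j′ i i′} → b ≡ b′ → j ≡ j′ → shift b + element i ≈ shift b′ + element i′ →
                   (b , j , i) ≡ (b′ , j′ , i′)
      same-index {b} {j = j} ≡.refl ≡.refl shifts≈ =
        ≡.cong (λ i → b , j , i) (element-injective (+-cancelˡ (shift b) _ _ shifts≈))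

    D-element-onto : ∀ {x} b {j u} → ActsAs x (σᵇ b c) j u → x ≃ D-element (b , j , index (u - shift b))
    D-element-onto b {j} {u} x-acts =
      ActsAs⇒≃ x-acts (ActsAs-cong refl ≡.refl shift+element≈u (D-element-actsAs b j (index (u - shift b))))
      where
      shift+element≈u : shift b + element (index (u - shift b)) ≈ u
      shift+element≈u = trans (+-congˡ (element-index _)) (trans (+-comm _ _) (//-rightDividesˡ (shift b) u))

    D-onto : ∀ x → ADoubleCoset g x → ∃ λ p → x ≃ D-element p
    D-onto x x∈D = let (b , j , u , x-acts) = D-form {x} x∈D in (b , j , index (u - shift b)) , D-element-onto b x-acts

    D-size : HasSize PermSetoid (ADoubleCoset g) (2 ℕ.* (2 ℕ.* suc N))
    D-size = HasSize-image PermSetoid (2*↔Bool× (2*↔Bool× ↔-refl)) D-element D-element∈D D-element-injective D-onto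

  even-index : ∀ g → Gp g → ¬ Ap g → EvenIndex g
  even-index g g∈G g∉A =
    let (c , jg , ug , c∈Norm1 , g-acts) = G-semiaffine g∈G
    in _ , _ , 1 , DoubleCoset.D-size c∈Norm1 g-acts g∉A , A-size , ≡.refl

open import Data.Nat using (_^_)

proposition3p5 : ∀ {c ℓ : Level} (d : ℕ) → 2 ≤ d →
    (F : CommutativeRing c ℓ) → IsField F → HasCardinality F (4 ^ d) →
    (ω : CommutativeRing.Carrier F) → IsMultGenerator F ω →
    let open Prop35Setup F d ω in
    (∀ g → Gp g → ¬ Ap g → EvenIndex g) ×
    ¬ IsPerfectCodeOfPair Gp Hp Ap
proposition3p5 (suc (suc e)) (s≤s (s≤s z≤n)) F isField card ω ω-generates = even-index , A-not-perfect
  where open Proposition35 F isField e card ω ω-generates
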